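{- Let $\mathcal{C}$ be a simplicial complex on $[n]$ and let $A$ be its full-rank representation matrix. Then $A$ has a square submatrix, formed by a set of columns whose size equals the number of rows of $A$, with determinant $1$.
   Context: The full-rank representation of the binary hierarchical model matrix of $\mathcal{C}$ is the matrix $A$ with rows indexed by all faces $F$ of $\mathcal{C}$ (including the empty face), columns indexed by $\mathbf{b}\in\{0,1\}^n$, and entry in row $F$, column $\mathbf{b}$ equal to $1$ if $b_i=0$ for all $i\in F$, and $0$ otherwise. -}

module Defs where

open import Data.Nat using (ℕ; zero; suc)
open import Data.Integer using (ℤ; +_; -_; _+_; _*_)
open import Data.Bool using (Bool; true; false; _∧_; not; if_then_else_)
open import Data.Fin using (Fin; zero; suc; punchIn)
open import Data.Vec using (Vec; []; _∷_; lookup)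
open import Data.List using (List; length)
open import Data.Fin.Subset using (Subset; ⊥; _⊆_)
open import Data.List.Membership.Propositional using (_∈_)
open import Data.List.Relation.Unary.Unique.Propositional using (Unique)

record SimplicialComplex (n : ℕ) : Set where
  field
    faces      : List (Subset n)
    faces-uniq : Unique faces
    empty-face : ⊥ ∈ faces
    down-closed : ∀ {F G : Subset n} → F ∈ faces → G ⊆ F → G ∈ faces

open SimplicialComplex public

numFaces : ∀ {n} → SimplicialComplex n → ℕ
numFaces C = length (faces C)

face : ∀ {n} (C : SimplicialComplex n) → Fin (numFaces C) → Subset n
face C i = Data.List.lookup (faces C) i

zeroOn : ∀ {n} → Subset n → Vec Bool n → Bool
zeroOn [] [] = true
zeroOn (f ∷ F) (b ∷ bs) = not (f ∧ b) ∧ zeroOn F bs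

-- The full-rank representation matrix A: rows = faces F, columns = b ∈ {0,1}^n
-- (b encoded as Vec Bool n, true = 1).
fullRankRep : ∀ {n} (C : SimplicialComplex n) → Fin (numFaces C) → Vec Bool n → ℤ
fullRankRep C F b = if zeroOn (face C F) b then + 1 else + 0

sumFin : ∀ {m} → (Fin m → ℤ) → ℤ
sumFin {zero} f = + 0
sumFin {suc m} f = f zero + sumFin (λ i → f (suc i))

signFin : ∀ {m} → Fin m → ℤ
signFin zero = + 1
signFin (suc j) = - signFin j

det : ∀ {m} → (Fin m → Fin m → ℤ) → ℤ
det {zero} M = + 1
det {suc m} M = sumFin (λ j → signFin j * (M zero j * det (λ r c → M (suc r) (punchIn j c))))

module Submission where

-- Take as columns the complements ∁ F of the faces F.  The entry
-- of A in row F and column ∁ G is 1 exactly when F ⊆ G, so the chosen square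
-- submatrix is the containment matrix of the faces.  The containment matrix
-- Z of ANY injective family of subsets has determinant 1: pick a subset F of
-- maximal size; then F ⊆ G forces F = G, so the row of F contains a single
-- nonzero entry, the diagonal 1.  Laplace expansion along that row gives
-- det Z = (-1)^r (-1)^r · 1 · det Z' where Z' is the containment matrix of
-- the remaining subsets, and induction finishes.

open import Defs
open import Data.Bool using (Bool; true; false; not; if_then_else_)
open import Data.Bool.Properties using (not-involutive)
open import Data.Vec using (Vec; []; _∷_; map; here; there)
open import Data.Vec.Properties using (map-∘; map-cong; map-id)
open import Data.Fin using (Fin; zero; suc; punchIn; punchOut)
open import Data.Fin.Properties using (punchIn-injective; punchInᵢ≢i; punchIn-punchOut)
open import Data.Fin.Subset using (Subset; _⊆_; ∁; ∣_∣; inside; outside)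
open import Data.Fin.Subset.Properties using (drop-∷-⊆; p⊆q⇒∣p∣≤∣q∣)
open import Data.Nat using (ℕ; _≤_; s≤s)
open import Data.Nat.Properties using (≤-refl; ≤-trans; ≤-total; 1+n≰n)
open import Data.Integer using (ℤ; +_; -_; _+_; _*_)
open import Data.Integer.Properties using (*-zeroʳ; *-assoc; +-identityˡ)
open import Data.Integer.Solver using (module +-*-Solver)
open import Data.Product using (Σ; _×_; _,_)
open import Data.Sum using (inj₁; inj₂)
open import Data.List using (List; _∷_; lookup)
open import Data.List.Membership.Propositional using (_∈_)
open import Data.List.Membership.Propositional.Properties using (∈-lookup)
open import Data.List.Relation.Unary.Unique.Propositional using (Unique)
open import Data.List.Relation.Unary.Unique.Propositional.Properties using (Unique[x∷xs]⇒x∉xs)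
open import Data.List.Relation.Unary.AllPairs using (_∷_)
open import Data.Empty using (⊥-elim)
open import Function.Definitions using (Injective)
open import Relation.Binary.PropositionalEquality
open ≡-Reasoning

open +-*-Solver using (solve; _:+_; _:*_; :-_; _:=_; con)

sumFin-cong : ∀ {m} (f g : Fin m → ℤ) → (∀ i → f i ≡ g i) → sumFin f ≡ sumFin g
sumFin-cong {ℕ.zero} f g f≡g = refl
sumFin-cong {ℕ.suc m} f g f≡g =
  cong₂ _+_ (f≡g zero) (sumFin-cong (λ i → f (suc i)) (λ i → g (suc i)) (λ i → f≡g (suc i)))

sumFin-zero : ∀ {m} (f : Fin m → ℤ) → (∀ i → f i ≡ + 0) → sumFin f ≡ + 0
sumFin-zero {m} f f≡0 = trans (sumFin-cong f (λ _ → + 0) f≡0) (zeros m)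
  where
  zeros : ∀ m → sumFin {m} (λ _ → + 0) ≡ + 0
  zeros ℕ.zero    = refl
  zeros (ℕ.suc m) = trans (+-identityˡ _) (zeros m)

sumFin-punch : ∀ {m} (f : Fin (ℕ.suc m) → ℤ) (c : Fin (ℕ.suc m)) →
  sumFin f ≡ f c + sumFin (λ j → f (punchIn c j))
sumFin-punch f zero = refl
sumFin-punch {ℕ.suc m} f (suc c) rewrite sumFin-punch (λ i → f (suc i)) c =
  solve 3 (λ a b s → a :+ (b :+ s) := b :+ (a :+ s)) refl
    (f zero) (f (suc c)) (sumFin (λ j → f (suc (punchIn c j))))

sumFin-scale : ∀ {m} (k : ℤ) (f : Fin m → ℤ) → k * sumFin f ≡ sumFin (λ j → k * f j)
sumFin-scale {ℕ.zero} k f = *-zeroʳ k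
sumFin-scale {ℕ.suc m} k f =
  trans (solve 3 (λ k a s → k :* (a :+ s) := k :* a :+ k :* s) refl k (f zero) (sumFin (λ i → f (suc i))))
        (cong (_+_ (k * f zero)) (sumFin-scale k (λ i → f (suc i))))

signFin-square : ∀ {m} (r : Fin m) → signFin r * signFin r ≡ + 1
signFin-square zero    = refl
signFin-square (suc r) =
  trans (solve 1 (λ s → (:- s) :* (:- s) := s :* s) refl (signFin r)) (signFin-square r)

minor : ∀ {m} → (Fin (ℕ.suc m) → Fin (ℕ.suc m) → ℤ) → Fin (ℕ.suc m) → Fin (ℕ.suc m) →
  Fin m → Fin m → ℤ
minor M r c a b = M (punchIn r a) (punchIn c b)

det-cong : ∀ {m} (M N : Fin m → Fin m → ℤ) → (∀ i j → M i j ≡ N i j) → det M ≡ det N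
det-cong {ℕ.zero} M N M≡N = refl
det-cong {ℕ.suc m} M N M≡N = sumFin-cong _ _ λ j →
  cong₂ (λ u v → signFin j * (u * v)) (M≡N zero j) (det-cong _ _ λ a b → M≡N (suc a) (punchIn j b))

term≡0ˡ : ∀ s a d → a ≡ + 0 → s * (a * d) ≡ + 0
term≡0ˡ s a d refl = solve 2 (λ s d → s :* (con (+ 0) :* d) := con (+ 0)) refl s d

term≡0ʳ : ∀ s a d → d ≡ + 0 → s * (a * d) ≡ + 0
term≡0ʳ s a d refl = solve 2 (λ s a → s :* (a :* con (+ 0)) := con (+ 0)) refl s a

-- A matrix with a zero row has determinant zero: a zero row zero kills every
-- entry of the expansion, a later zero row kills every minor.
det-zero-row : ∀ {m} (M : Fin m → Fin m → ℤ) (r : Fin m) → (∀ j → M r j ≡ + 0) → det M ≡ + 0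
det-zero-row {ℕ.suc m} M zero row≡0 = sumFin-zero _ λ j →
  term≡0ˡ (signFin j) (M zero j) (det (minor M zero j)) (row≡0 j)
det-zero-row {ℕ.suc m} M (suc r) row≡0 = sumFin-zero _ λ j →
  term≡0ʳ (signFin j) (M zero j) (det (minor M zero j))
    (det-zero-row (minor M zero j) r (λ b → row≡0 (punchIn j b)))

-- Deleting column punchIn c j and then the column punchOut p equals deleting
-- column c and then column j: both remove the same two columns.
punchIn-punchIn-punchOut : ∀ {m} (c : Fin (ℕ.suc (ℕ.suc m))) (j : Fin (ℕ.suc m))
  (p : punchIn c j ≢ c) (b : Fin m) →
  punchIn (punchIn c j) (punchIn (punchOut p) b) ≡ punchIn c (punchIn j b)
punchIn-punchIn-punchOut zero j p b = refl
punchIn-punchIn-punchOut (suc c) zero p b = refl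
punchIn-punchIn-punchOut {ℕ.suc m} (suc c) (suc j) p zero = refl
punchIn-punchIn-punchOut {ℕ.suc m} (suc c) (suc j) p (suc b) =
  cong suc (punchIn-punchIn-punchOut c j (λ e → p (cong suc e)) b)

-- The matching sign identity: the two orders of deletion differ by one
-- transposition.
signFin-punchIn-punchOut : ∀ {m} (c : Fin (ℕ.suc (ℕ.suc m))) (j : Fin (ℕ.suc m))
  (p : punchIn c j ≢ c) →
  signFin (punchIn c j) * signFin (punchOut p) ≡ - (signFin c * signFin j)
signFin-punchIn-punchOut zero j p =
  solve 1 (λ s → (:- s) :* con (+ 1) := :- (con (+ 1) :* s)) refl (signFin j)
signFin-punchIn-punchOut (suc c) zero p =
  solve 1 (λ s → con (+ 1) :* s := :- ((:- s) :* con (+ 1))) refl (signFin c)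
signFin-punchIn-punchOut {ℕ.suc m} (suc c) (suc j) p = begin
  - signFin (punchIn c j) * - signFin (punchOut p′)
    ≡⟨ solve 2 (λ a b → (:- a) :* (:- b) := a :* b) refl (signFin (punchIn c j)) (signFin (punchOut p′)) ⟩
  signFin (punchIn c j) * signFin (punchOut p′)
    ≡⟨ signFin-punchIn-punchOut c j p′ ⟩
  - (signFin c * signFin j)
    ≡⟨ solve 2 (λ a b → :- (a :* b) := :- ((:- a) :* (:- b))) refl (signFin c) (signFin j) ⟩
  - (- signFin c * - signFin j) ∎
  where
  p′ : punchIn c j ≢ c
  p′ e = p (cong suc e)

-- Since det is defined by
-- expansion along row zero, this is proved by induction on r.
det-single-entry-row : ∀ {m} (M : Fin (ℕ.suc m) → Fin (ℕ.suc m) → ℤ) (r c : Fin (ℕ.suc m)) →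
  (∀ j → j ≢ c → M r j ≡ + 0) →
  det M ≡ (signFin r * signFin c) * (M r c * det (minor M r c))
det-single-entry-row M zero c others≡0 = begin
  det M
    ≡⟨ sumFin-punch term c ⟩
  term c + sumFin (λ j → term (punchIn c j))
    ≡⟨ cong (_+_ (term c)) (sumFin-zero _ λ j → other≡0 (punchIn c j) (punchInᵢ≢i c j)) ⟩
  term c + + 0
    ≡⟨ solve 3 (λ s a d → s :* (a :* d) :+ con (+ 0) := (con (+ 1) :* s) :* (a :* d)) refl
         (signFin c) (M zero c) (det (minor M zero c)) ⟩
  (+ 1 * signFin c) * (M zero c * det (minor M zero c)) ∎
  where
  term : Fin _ → ℤ
  term j = signFin j * (M zero j * det (minor M zero j))
  other≡0 : ∀ j → j ≢ c → term j ≡ + 0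
  other≡0 j j≢c = term≡0ˡ (signFin j) (M zero j) (det (minor M zero j)) (others≡0 j j≢c)
det-single-entry-row {ℕ.suc m} M (suc r) c others≡0 = begin
  det M
    ≡⟨ sumFin-punch term c ⟩
  term c + sumFin (λ j → term (punchIn c j))
    ≡⟨ cong₂ _+_ term-c≡0 (sumFin-cong _ _ term-punchIn) ⟩
  + 0 + sumFin (λ j → k * T j)
    ≡⟨ +-identityˡ _ ⟩
  sumFin (λ j → k * T j)
    ≡⟨ sym (sumFin-scale k T) ⟩
  k * det (minor M (suc r) c)
    ≡⟨ *-assoc (signFin (suc r) * signFin c) (M (suc r) c) (det (minor M (suc r) c)) ⟩
  (signFin (suc r) * signFin c) * (M (suc r) c * det (minor M (suc r) c)) ∎
  where
  term : Fin _ → ℤ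
  term j = signFin j * (M zero j * det (minor M zero j))
  k : ℤ
  k = (signFin (suc r) * signFin c) * M (suc r) c
  -- the Laplace terms of det (minor M (suc r) c) along its row zero
  T : Fin _ → ℤ
  T j = signFin j * (M zero (punchIn c j) * det (minor (minor M (suc r) c) zero j))

  -- column c: the minor keeps row suc r with column c deleted, a zero row
  term-c≡0 : term c ≡ + 0
  term-c≡0 = term≡0ʳ (signFin c) (M zero c) (det (minor M zero c))
    (det-zero-row (minor M zero c) r (λ b → others≡0 (punchIn c b) (punchInᵢ≢i c b)))

  -- other columns: expand the minor along its row r (induction hypothesis)
  -- and reorder the deleted columns
  term-punchIn : ∀ j → term (punchIn c j) ≡ k * T j
  term-punchIn j = begin
    X * (a * det N)
      ≡⟨ cong (λ u → X * (a * u)) (det-single-entry-row N r c′ N-others≡0) ⟩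
    X * (a * ((signFin r * Y) * (N r c′ * D₁)))
      ≡⟨ cong₂ (λ u v → X * (a * ((signFin r * Y) * (u * v)))) N-r-c′ D₁≡D₂ ⟩
    X * (a * ((signFin r * Y) * (M (suc r) c * D₂)))
      ≡⟨ solve 6 (λ X a sr Y e D → X :* (a :* ((sr :* Y) :* (e :* D))) := (X :* Y) :* (sr :* e :* (a :* D)))
           refl X a (signFin r) Y (M (suc r) c) D₂ ⟩
    (X * Y) * (signFin r * M (suc r) c * (a * D₂))
      ≡⟨ cong (_* (signFin r * M (suc r) c * (a * D₂))) (signFin-punchIn-punchOut c j p) ⟩
    - (signFin c * signFin j) * (signFin r * M (suc r) c * (a * D₂))
      ≡⟨ solve 5 (λ sc sj sr e A → :- (sc :* sj) :* (sr :* e :* A) := ((:- sr) :* sc) :* e :* (sj :* A))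
           refl (signFin c) (signFin j) (signFin r) (M (suc r) c) (a * D₂) ⟩
    k * T j ∎
    where
    p : punchIn c j ≢ c
    p = punchInᵢ≢i c j
    c′ : Fin (ℕ.suc m)
    c′ = punchOut p
    N : Fin (ℕ.suc m) → Fin (ℕ.suc m) → ℤ
    N = minor M zero (punchIn c j)
    X Y a D₁ D₂ : ℤ
    X = signFin (punchIn c j)
    Y = signFin c′
    a = M zero (punchIn c j)
    D₁ = det (minor N r c′)
    D₂ = det (minor (minor M (suc r) c) zero j)
    N-r-c′ : N r c′ ≡ M (suc r) c
    N-r-c′ = cong (M (suc r)) (punchIn-punchOut p)
    N-others≡0 : ∀ b → b ≢ c′ → N r b ≡ + 0
    N-others≡0 b b≢c′ = others≡0 _ λ e →
      b≢c′ (punchIn-injective (punchIn c j) b c′ (trans e (sym (punchIn-punchOut p))))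
    D₁≡D₂ : D₁ ≡ D₂
    D₁≡D₂ = det-cong _ _ λ a′ b → cong (M (suc (punchIn r a′))) (punchIn-punchIn-punchOut c j p b)

∁-involutive : ∀ {n} (p : Subset n) → ∁ (∁ p) ≡ p
∁-involutive p = begin
  map not (map not p) ≡⟨ map-∘ not not p ⟨
  map (λ b → not (not b)) p ≡⟨ map-cong not-involutive p ⟩
  map (λ b → b) p ≡⟨ map-id p ⟩
  p ∎

zeroOn-∁-self : ∀ {n} (F : Subset n) → zeroOn F (∁ F) ≡ true
zeroOn-∁-self []            = refl
zeroOn-∁-self (inside ∷ F)  = zeroOn-∁-self F
zeroOn-∁-self (outside ∷ F) = zeroOn-∁-self F

zeroOn-∁⇒⊆ : ∀ {n} (F G : Subset n) → zeroOn F (∁ G) ≡ true → F ⊆ G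
zeroOn-∁⇒⊆ (inside ∷ F)  (inside ∷ G) e here           = here
zeroOn-∁⇒⊆ (inside ∷ F)  (inside ∷ G) e (there x∈F)    = there (zeroOn-∁⇒⊆ F G e x∈F)
zeroOn-∁⇒⊆ (inside ∷ F)  (outside ∷ G) () _
zeroOn-∁⇒⊆ (outside ∷ F) (_ ∷ G)       e (there x∈F)    = there (zeroOn-∁⇒⊆ F G e x∈F)

⊆-size-eq : ∀ {n} (F G : Subset n) → F ⊆ G → ∣ G ∣ ≤ ∣ F ∣ → F ≡ G
⊆-size-eq []            []            F⊆G G≤F = refl
⊆-size-eq (inside ∷ F)  (inside ∷ G)  F⊆G (s≤s G≤F) =
  cong (inside ∷_) (⊆-size-eq F G (drop-∷-⊆ F⊆G) G≤F)
⊆-size-eq (inside ∷ F)  (outside ∷ G) F⊆G G≤F with F⊆G here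
... | ()
⊆-size-eq (outside ∷ F) (inside ∷ G)  F⊆G G≤F =
  ⊥-elim (1+n≰n (≤-trans G≤F (p⊆q⇒∣p∣≤∣q∣ (drop-∷-⊆ F⊆G))))
⊆-size-eq (outside ∷ F) (outside ∷ G) F⊆G G≤F =
  cong (outside ∷_) (⊆-size-eq F G (drop-∷-⊆ F⊆G) G≤F)

containment : ∀ {n m} → (Fin m → Subset n) → Fin m → Fin m → ℤ
containment x i j = if zeroOn (x i) (∁ (x j)) then + 1 else + 0

maximal-index : ∀ {m} (f : Fin (ℕ.suc m) → ℕ) → Σ (Fin (ℕ.suc m)) λ r → ∀ j → f j ≤ f r
maximal-index {ℕ.zero} f = zero , λ { zero → ≤-refl }
maximal-index {ℕ.suc m} f with maximal-index (λ i → f (suc i))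
... | r , f≤fr with ≤-total (f zero) (f (suc r))
...   | inj₁ f0≤ = suc r , λ { zero → f0≤ ; (suc j) → f≤fr j }
...   | inj₂ ≤f0 = zero  , λ { zero → ≤-refl ; (suc j) → ≤-trans (f≤fr j) ≤f0 }

-- In an injective family, a subset of maximal size is contained in no other
-- member: its row of the containment matrix vanishes off the diagonal.
maximal-row-off-diagonal : ∀ {n m} (x : Fin m → Subset n) → Injective _≡_ _≡_ x →
  (r : Fin m) → (∀ j → ∣ x j ∣ ≤ ∣ x r ∣) → ∀ j → j ≢ r → containment x r j ≡ + 0
maximal-row-off-diagonal x x-inj r maximal j j≢r with zeroOn (x r) (∁ (x j)) in xr⊆xj
... | true  = ⊥-elim (j≢r (x-inj (sym (⊆-size-eq (x r) (x j) (zeroOn-∁⇒⊆ (x r) (x j) xr⊆xj) (maximal j)))))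
... | false = refl

det-containment : ∀ {n} m (x : Fin m → Subset n) → Injective _≡_ _≡_ x → det (containment x) ≡ + 1
det-containment ℕ.zero x x-inj = refl
det-containment (ℕ.suc m) x x-inj with maximal-index (λ i → ∣ x i ∣)
... | r , maximal = begin
  det (containment x)
    ≡⟨ det-single-entry-row (containment x) r r (maximal-row-off-diagonal x x-inj r maximal) ⟩
  (signFin r * signFin r) * (containment x r r * det (containment x′))
    ≡⟨ cong₂ (λ s e → s * (e * det (containment x′))) (signFin-square r)
             (cong (λ b → if b then + 1 else + 0) (zeroOn-∁-self (x r))) ⟩
  + 1 * (+ 1 * det (containment x′))
    ≡⟨ cong (λ d → + 1 * (+ 1 * d)) (det-containment m x′ x′-inj) ⟩
  + 1 ∎
  where
  x′ : Fin m → Subset _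
  x′ a = x (punchIn r a)
  x′-inj : Injective _≡_ _≡_ x′
  x′-inj e = punchIn-injective r _ _ (x-inj e)

lookup-injective : ∀ {A : Set} {xs : List A} → Unique xs → Injective _≡_ _≡_ (lookup xs)
lookup-injective {xs = _ ∷ _} _ {zero} {zero} _ = refl
lookup-injective {xs = _ ∷ xs} u {zero} {suc j} e =
  ⊥-elim (Unique[x∷xs]⇒x∉xs u (subst (_∈ xs) (sym e) (∈-lookup j)))
lookup-injective {xs = _ ∷ xs} u {suc i} {zero} e =
  ⊥-elim (Unique[x∷xs]⇒x∉xs u (subst (_∈ xs) e (∈-lookup i)))
lookup-injective {xs = _ ∷ _} (_ ∷ u) {suc i} {suc j} e = cong suc (lookup-injective u e)

-- Columns: the complements ∁ G of the faces G.  The entry in row F is then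
-- [F ⊆ G], so the submatrix is the containment matrix of the distinct faces.
proposition5p5 : ∀ {n} (C : SimplicialComplex n) →
    Σ (Fin (numFaces C) → Vec Bool n) λ cols →
      Injective _≡_ _≡_ cols × det (λ i j → fullRankRep C i (cols j)) ≡ + 1
proposition5p5 C = cols , cols-injective , det-containment (numFaces C) (face C) face-injective
  where
  cols : Fin (numFaces C) → Vec Bool _
  cols j = ∁ (face C j)
  face-injective : Injective _≡_ _≡_ (face C)
  face-injective = lookup-injective (faces-uniq C)
  cols-injective : Injective _≡_ _≡_ cols
  cols-injective {i} {j} e = face-injective (begin
    face C i         ≡⟨ ∁-involutive (face C i) ⟨
    ∁ (cols i)       ≡⟨ cong ∁ e ⟩
    ∁ (cols j)       ≡⟨ ∁-involutive (face C j) ⟩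
    face C j         ∎)
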